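{- Let $m\ge 1$, let $f(x_1,\ldots,x_m)$ be a polynomial with integer coefficients, and consider the loop \[ {\tt P_2}:\quad {\bf while}\ \big(x_{m+1}-f(x_1,\ldots,x_m)^2>0\big)\ \{X:=AX\}, \] where $X=(x_1,\ldots,x_{m+1})^{\mathrm T}$ and $A=\mathrm{diag}(1,\ldots,1,1/2)$ is the $(m+1)\times(m+1)$ diagonal matrix. Then ${\tt P_2}$ terminates on every input $(x_1,\ldots,x_{m+1})\in\mathbb{Z}^{m+1}$ if and only if $f(x_1,\ldots,x_m)=0$ has no integer solution $(x_1,\ldots,x_m)\in\mathbb{Z}^m$.
   Context: A loop terminates on an input $X$ if, starting from $X$ and repeatedly replacing $X$ by $AX$, the loop condition eventually becomes false (i.e. there is $n\ge 0$ such that the condition fails at $A^nX$). -}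

module Defs where

open import Data.Nat using (ℕ; zero; suc)
open import Data.Fin using (Fin; fromℕ; inject₁; _≟_)
open import Data.Integer using (ℤ)
import Data.Integer as ℤ
open import Data.Rational using (ℚ; 0ℚ; 1ℚ; ½; _+_; _*_; _-_; _<_; _/_)
open import Data.Vec.Functional using (Vector; foldr)
open import Data.Product using (∃)
open import Relation.Nullary using (¬_; yes; no)

data Poly (m : ℕ) : Set where
  con : ℤ → Poly m
  var : Fin m → Poly m
  _⊕_ : Poly m → Poly m → Poly m
  _⊗_ : Poly m → Poly m → Poly m

evalℤ : ∀ {m} → Poly m → (Fin m → ℤ) → ℤ
evalℤ (con c) x = c
evalℤ (var i) x = x i
evalℤ (p ⊕ q) x = evalℤ p x ℤ.+ evalℤ q x
evalℤ (p ⊗ q) x = evalℤ p x ℤ.* evalℤ q x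

evalℚ : ∀ {m} → Poly m → (Fin m → ℚ) → ℚ
evalℚ (con c) x = c / 1
evalℚ (var i) x = x i
evalℚ (p ⊕ q) x = evalℚ p x + evalℚ q x
evalℚ (p ⊗ q) x = evalℚ p x * evalℚ q x

Matrix : ℕ → Set
Matrix n = Fin n → Fin n → ℚ

_·_ : ∀ {n} → Matrix n → Vector ℚ n → Vector ℚ n
(A · X) i = foldr _+_ 0ℚ (λ j → A i j * X j)

-- A = diag(1,…,1,1/2), of size (m+1)×(m+1); the last index is x_{m+1}
A : (m : ℕ) → Matrix (suc m)
A m i j with i ≟ j
... | no _ = 0ℚ
... | yes _ with i ≟ fromℕ m
...   | yes _ = ½
...   | no _ = 1ℚ

iter : ∀ {n} → Matrix n → ℕ → Vector ℚ n → Vector ℚ n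
iter M zero X = X
iter M (suc k) X = M · iter M k X

cond : (m : ℕ) → Poly m → Vector ℚ (suc m) → Set
cond m f X = 0ℚ < X (fromℕ m) - evalℚ f (λ i → X (inject₁ i)) * evalℚ f (λ i → X (inject₁ i))

Terminates : (m : ℕ) → Poly m → Vector ℚ (suc m) → Set
Terminates m f X = ∃ λ n → ¬ cond m f (iter (A m) n X)

module Submission where

-- The matrix A is diagonal, so the orbit of X keeps x₁,…,xₘ fixed and halves
-- x_{m+1} at every step.  Consequently:
--  * if f(y) = 0, the input (y, 1) never terminates: the loop condition reads
--    x_{m+1} > 0, and a positive number stays positive under halving;
--  * if f has no integer root, then f(y)² ≥ 1 for every integer input, and after
--    |x_{m+1}| halvings the last coordinate is ≤ 1, so the condition fails.

open import Defs
open import Data.Nat using (ℕ; suc; _≥_)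
open import Data.Fin using (Fin)
open import Data.Integer using (ℤ)
import Data.Integer as ℤ
open import Data.Rational using (_/_)
open import Data.Product using (∃; _×_)
open import Relation.Nullary using (¬_)
open import Relation.Binary.PropositionalEquality using (_≡_)

import Data.Nat as ℕ
import Data.Nat.Properties as ℕP
import Data.Integer.Properties as ℤP
open import Data.Integer using (+_; -[1+_])
open import Data.Fin using (zero; suc; fromℕ; inject₁; _≟_)
import Data.Fin.Properties as FP
open import Data.Rational using (ℚ; mkℚ; *≤*; 0ℚ; 1ℚ; ½; _+_; _*_; _-_; -_; _<_; _≤_)
import Data.Rational.Properties as QP
import Data.Nat.Coprimality as Coprime
open import Data.Vec.Functional using (Vector; foldr)
open import Data.Product using (_,_)
open import Data.Empty using (⊥-elim)
open import Relation.Nullary using (yes; no)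
open import Relation.Binary.PropositionalEquality
  using (refl; sym; trans; cong; cong₂; _≢_; subst; subst₂; module ≡-Reasoning)

ι : ℤ → ℚ
ι z = z / 1

ι-normal : ∀ z → ι z ≡ mkℚ z 0 (Coprime.sym (Coprime.1-coprimeTo ℤ.∣ z ∣))
ι-normal z = QP.↥p/↧p≡p (mkℚ z 0 (Coprime.sym (Coprime.1-coprimeTo ℤ.∣ z ∣)))

ι-+ : ∀ a b → ι a + ι b ≡ ι (a ℤ.+ b)
ι-+ a b rewrite ι-normal a | ι-normal b =
  QP./-cong (cong₂ ℤ._+_ (ℤP.*-identityʳ a) (ℤP.*-identityʳ b)) refl

ι-* : ∀ a b → ι a * ι b ≡ ι (a ℤ.* b)
ι-* a b rewrite ι-normal a | ι-normal b = refl

ι-mono : ∀ {a b} → a ℤ.≤ b → ι a ≤ ι b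
ι-mono {a} {b} a≤b rewrite ι-normal a | ι-normal b =
  *≤* (subst₂ ℤ._≤_ (sym (ℤP.*-identityʳ a)) (sym (ℤP.*-identityʳ b)) a≤b)

evalℚ-cong : ∀ {m} (f : Poly m) {x y : Fin m → ℚ} → (∀ i → x i ≡ y i) → evalℚ f x ≡ evalℚ f y
evalℚ-cong (con c) x≡y = refl
evalℚ-cong (var i) x≡y = x≡y i
evalℚ-cong (p ⊕ q) x≡y = cong₂ _+_ (evalℚ-cong p x≡y) (evalℚ-cong q x≡y)
evalℚ-cong (p ⊗ q) x≡y = cong₂ _*_ (evalℚ-cong p x≡y) (evalℚ-cong q x≡y)

evalℚ-ι : ∀ {m} (f : Poly m) (y : Fin m → ℤ) → evalℚ f (λ i → ι (y i)) ≡ ι (evalℤ f y)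
evalℚ-ι (con c) y = refl
evalℚ-ι (var i) y = refl
evalℚ-ι (p ⊕ q) y = trans (cong₂ _+_ (evalℚ-ι p y) (evalℚ-ι q y)) (ι-+ (evalℤ p y) (evalℤ q y))
evalℚ-ι (p ⊗ q) y = trans (cong₂ _*_ (evalℚ-ι p y) (evalℚ-ι q y)) (ι-* (evalℤ p y) (evalℤ q y))

sum-zero : ∀ {n} (g : Fin n → ℚ) → (∀ j → g j ≡ 0ℚ) → foldr _+_ 0ℚ g ≡ 0ℚ
sum-zero {ℕ.zero} g g≡0 = refl
sum-zero {suc n} g g≡0
  rewrite g≡0 zero | sum-zero (λ j → g (suc j)) (λ j → g≡0 (suc j)) = refl

sum-single : ∀ {n} (g : Fin n → ℚ) (k : Fin n) → (∀ j → j ≢ k → g j ≡ 0ℚ) → foldr _+_ 0ℚ g ≡ g k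
sum-single {suc n} g zero g≡0
  rewrite sum-zero (λ j → g (suc j)) (λ j → g≡0 (suc j) (λ ())) = QP.+-identityʳ (g zero)
sum-single {suc n} g (suc k) g≡0
  rewrite g≡0 zero (λ ())
        | sum-single (λ j → g (suc j)) k (λ j j≢k → g≡0 (suc j) (λ e → j≢k (FP.suc-injective e)))
  = QP.+-identityˡ (g (suc k))

Diagonal : ∀ {n} → Matrix n → Set
Diagonal M = ∀ i j → j ≢ i → M i j ≡ 0ℚ

diagonal-· : ∀ {n} {M : Matrix n} → Diagonal M → ∀ X i → (M · X) i ≡ M i i * X i
diagonal-· {M = M} diag X i =
  sum-single (λ j → M i j * X j) i (λ j j≢i → trans (cong (_* X j) (diag i j j≢i)) (QP.*-zeroˡ (X j)))

diagonal-iter : ∀ {n} {M : Matrix n} → Diagonal M → ∀ k X i → iter M (suc k) X i ≡ M i i * iter M k X i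
diagonal-iter diag k X = diagonal-· diag (iter _ k X)

A-diagonal : ∀ m → Diagonal (A m)
A-diagonal m i j j≢i with i ≟ j
... | yes i≡j = ⊥-elim (j≢i (sym i≡j))
... | no _ = refl

A-last : ∀ m → A m (fromℕ m) (fromℕ m) ≡ ½
A-last m with fromℕ m ≟ fromℕ m
... | no ≢ = ⊥-elim (≢ refl)
... | yes _ with fromℕ m ≟ fromℕ m
...   | yes _ = refl
...   | no ≢ = ⊥-elim (≢ refl)

A-init : ∀ m (i : Fin m) → A m (inject₁ i) (inject₁ i) ≡ 1ℚ
A-init m i with inject₁ i ≟ inject₁ i
... | no ≢ = ⊥-elim (≢ refl)
... | yes _ with inject₁ i ≟ fromℕ m
...   | yes ≡last = ⊥-elim (FP.fromℕ≢inject₁ (sym ≡last))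
...   | no _ = refl

orbit-init : ∀ m k (X : Vector ℚ (suc m)) (i : Fin m) → iter (A m) k X (inject₁ i) ≡ X (inject₁ i)
orbit-init m ℕ.zero X i = refl
orbit-init m (suc k) X i = begin
  iter (A m) (suc k) X (inject₁ i)   ≡⟨ diagonal-iter (A-diagonal m) k X (inject₁ i) ⟩
  A m (inject₁ i) (inject₁ i) * _    ≡⟨ cong₂ _*_ (A-init m i) (orbit-init m k X i) ⟩
  1ℚ * X (inject₁ i)                 ≡⟨ QP.*-identityˡ _ ⟩
  X (inject₁ i)                      ∎
  where open ≡-Reasoning

Halving : (ℕ → ℚ) → Set
Halving s = ∀ k → s (suc k) ≡ ½ * s k

orbit-last : ∀ m (X : Vector ℚ (suc m)) → Halving (λ k → iter (A m) k X (fromℕ m))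
orbit-last m X k = trans (diagonal-iter (A-diagonal m) k X (fromℕ m)) 
  (cong (_* iter (A m) k X (fromℕ m)) (A-last m))

halving-pos : ∀ s → Halving s → 0ℚ < s 0 → ∀ k → 0ℚ < s k
halving-pos s halves pos ℕ.zero = pos
halving-pos s halves pos (suc k) rewrite halves k = QP.*-monoʳ-<-pos ½ (halving-pos s halves pos k)

-- Halving a number at most k+2 gives a number at most k+1, since k+2 ≤ 2(k+1).
half-step : ∀ k c → c ≤ ι (+ suc (suc k)) → ½ * c ≤ ι (+ suc k)
half-step k c c≤k+2 = QP.*-cancelˡ-≤-pos two (begin
    two * (½ * c)          ≡⟨ QP.*-assoc two ½ c ⟨
    1ℚ * c                 ≡⟨ QP.*-identityˡ c ⟩
    c                      ≤⟨ c≤k+2 ⟩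
    ι (+ suc (suc k))      ≤⟨ ι-mono (ℤ.+≤+ (k+2≤2[k+1] k)) ⟩
    ι (+ 2 ℤ.* + suc k)    ≡⟨ ι-* (+ 2) (+ suc k) ⟨
    two * ι (+ suc k)      ∎)
  where
  open QP.≤-Reasoning
  two : ℚ
  two = ι (+ 2)
  k+2≤2[k+1] : ∀ n → suc (suc n) ℕ.≤ 2 ℕ.* suc n
  k+2≤2[k+1] n = ℕ.s≤s (subst (suc n ℕ.≤_) (sym (ℕP.+-suc n (n ℕ.+ 0)))
                              (ℕ.s≤s (ℕP.m≤m+n n (n ℕ.+ 0))))

halving-≤1 : ∀ k s → Halving s → s 0 ≤ ι (+ suc k) → s k ≤ 1ℚ
halving-≤1 ℕ.zero s halves s0≤1 = s0≤1
halving-≤1 (suc k) s halves s0≤k+2 =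
  halving-≤1 k (λ j → s (suc j)) (λ j → halves (suc j))
    (subst (_≤ ι (+ suc k)) (sym (halves 0)) (half-step k (s 0) s0≤k+2))

condition-fails : ∀ {c G} → c ≤ G → ¬ (0ℚ < c - G)
condition-fails {c} {G} c≤G 0<c-G = QP.<-irrefl refl (QP.<-≤-trans 0<c-G c-G≤0)
  where
  c-G≤0 : c - G ≤ 0ℚ
  c-G≤0 = subst (c - G ≤_) (QP.+-inverseʳ G) (QP.+-monoˡ-≤ (- G) c≤G)

square-≥1 : ∀ z → z ≢ ℤ.0ℤ → + 1 ℤ.≤ z ℤ.* z
square-≥1 (+ ℕ.zero) z≢0 = ⊥-elim (z≢0 refl)
square-≥1 (+ suc n) z≢0 = ℤ.+≤+ (ℕ.s≤s ℕ.z≤n)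
square-≥1 -[1+ n ] z≢0 = ℤ.+≤+ (ℕ.s≤s ℕ.z≤n)

-- Every integer is below 1 + |a|; this bounds the number of halvings needed.
≤-suc-abs : ∀ a → a ℤ.≤ + suc ℤ.∣ a ∣
≤-suc-abs (+ n) = ℤ.+≤+ (ℕP.n≤1+n n)
≤-suc-abs -[1+ n ] = ℤ.-≤+

snoc : ∀ {m} → (Fin m → ℤ) → ℤ → Fin (suc m) → ℤ
snoc {ℕ.zero} y z zero = z
snoc {suc m} y z zero = y zero
snoc {suc m} y z (suc i) = snoc (λ j → y (suc j)) z i

snoc-last : ∀ {m} (y : Fin m → ℤ) z → snoc y z (fromℕ m) ≡ z
snoc-last {ℕ.zero} y z = refl
snoc-last {suc m} y z = snoc-last (λ j → y (suc j)) z

snoc-init : ∀ {m} (y : Fin m → ℤ) z i → snoc y z (inject₁ i) ≡ y i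
snoc-init {suc m} y z zero = refl
snoc-init {suc m} y z (suc i) = snoc-init (λ j → y (suc j)) z i

orbit-eval : ∀ m (f : Poly m) (X : Vector ℚ (suc m)) (y : Fin m → ℤ) →
  (∀ i → X (inject₁ i) ≡ ι (y i)) →
  ∀ k → evalℚ f (λ i → iter (A m) k X (inject₁ i)) ≡ ι (evalℤ f y)
orbit-eval m f X y X≡y k =
  trans (evalℚ-cong f (λ i → trans (orbit-init m k X i) (X≡y i))) (evalℚ-ι f y)

-- A root y of f makes the input (y, 1) loop forever: f vanishes along the
-- orbit while the last coordinate stays positive.
root-diverges : ∀ m (f : Poly m) (y : Fin m → ℤ) → evalℤ f y ≡ ℤ.0ℤ →
  ∀ k → cond m f (iter (A m) k (λ i → ι (snoc y (+ 1) i)))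
root-diverges m f y root k =
  subst (λ F → 0ℚ < last - F * F) (sym f-vanishes) (subst (0ℚ <_) (sym (QP.+-identityʳ last)) last-pos)
  where
  X : Vector ℚ (suc m)
  X i = ι (snoc y (+ 1) i)
  last : ℚ
  last = iter (A m) k X (fromℕ m)
  f-vanishes : evalℚ f (λ i → iter (A m) k X (inject₁ i)) ≡ 0ℚ
  f-vanishes = trans (orbit-eval m f X y (λ i → cong ι (snoc-init y (+ 1) i)) k) (cong ι root)
  last-pos : 0ℚ < last
  last-pos = halving-pos (λ j → iter (A m) j X (fromℕ m)) (orbit-last m X)
    (subst (λ z → 0ℚ < ι z) (sym (snoc-last y (+ 1))) (QP.positive⁻¹ 1ℚ)) k

-- Without integer roots, f² ≥ 1 at every integer point while the last
-- coordinate of the orbit drops to at most 1 after |x_{m+1}| steps.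
rootless-terminates : ∀ m (f : Poly m) → ¬ (∃ λ (y : Fin m → ℤ) → evalℤ f y ≡ ℤ.0ℤ) →
  (x : Fin (suc m) → ℤ) → Terminates m f (λ i → ι (x i))
rootless-terminates m f no-root x =
  k , condition-fails (QP.≤-trans last≤1 (subst (1ℚ ≤_) (sym f²≡) 1≤f²))
  where
  X : Vector ℚ (suc m)
  X i = ι (x i)
  y : Fin m → ℤ
  y i = x (inject₁ i)
  k : ℕ
  k = ℤ.∣ x (fromℕ m) ∣
  last≤1 : iter (A m) k X (fromℕ m) ≤ 1ℚ
  last≤1 = halving-≤1 k (λ j → iter (A m) j X (fromℕ m)) (orbit-last m X) (ι-mono (≤-suc-abs (x (fromℕ m))))
  f-at-y : evalℚ f (λ i → iter (A m) k X (inject₁ i)) ≡ ι (evalℤ f y)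
  f-at-y = orbit-eval m f X y (λ i → refl) k
  f²≡ : evalℚ f (λ i → iter (A m) k X (inject₁ i)) * evalℚ f (λ i → iter (A m) k X (inject₁ i))
        ≡ ι (evalℤ f y ℤ.* evalℤ f y)
  f²≡ = trans (cong₂ _*_ f-at-y f-at-y) (ι-* (evalℤ f y) (evalℤ f y))
  1≤f² : 1ℚ ≤ ι (evalℤ f y ℤ.* evalℤ f y)
  1≤f² = ι-mono (square-≥1 (evalℤ f y) (λ root → no-root (y , root)))

-- The theorem.
lemma1 : (m : ℕ) → m ≥ 1 → (f : Poly m) →
    (((x : Fin (suc m) → ℤ) → Terminates m f (λ i → x i / 1)) → ¬ (∃ λ (y : Fin m → ℤ) → evalℤ f y ≡ ℤ.0ℤ))
    × ((¬ (∃ λ (y : Fin m → ℤ) → evalℤ f y ≡ ℤ.0ℤ)) → (x : Fin (suc m) → ℤ) → Terminates m f (λ i → x i / 1))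
lemma1 m _ f = terminating⇒rootless , rootless-terminates m f
  where
  terminating⇒rootless : ((x : Fin (suc m) → ℤ) → Terminates m f (λ i → x i / 1)) →
    ¬ (∃ λ (y : Fin m → ℤ) → evalℤ f y ≡ ℤ.0ℤ)
  terminating⇒rootless terminates (y , root) with terminates (snoc y (+ 1))
  ... | k , stops = stops (root-diverges m f y root k)
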